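{- For each $i \geq 5$, the net occurrences in $T_i$ are exactly the occurrences of the strings in $\mathcal{P}_i := \{ T_{i-2}, \ \overline{T_{i-2}}, \ T_{i-4} \ \overline{T_{i-3}}, \ \overline{T_{i-4}} \ T_{i-3} \}$; every occurrence of each of these strings is a net occurrence, and there are no other net occurrences in $T_i$. (Namely, $T_{i-2}$ occurs at positions $1$, $\tau_{i-2}+\tau_{i-3}+1$, $\tau_{i-1}+\tau_{i-2}+1$; $\overline{T_{i-2}}$ at $\tau_{i-2}+1$, $\tau_{i-1}+1$; $T_{i-4}\overline{T_{i-3}}$ at $\tau_{i-3}+\tau_{i-4}+1$, $\tau_{i-1}+\tau_{i-3}+1$; $\overline{T_{i-4}}T_{i-3}$ at $\tau_{i-3}+1$, $\tau_{i-1}+\tau_{i-3}+\tau_{i-4}+1$, giving exactly nine net occurrences.)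
   Context: Strings are over the binary alphabet $\{\texttt{a},\texttt{b}\}$. For a binary string $S$, $\overline{S}$ denotes the string obtained by simultaneously replacing each \texttt{a} with \texttt{b} and each \texttt{b} with \texttt{a}. The Thue-Morse word of order $i$ is $T_i$, where $T_1 := \texttt{a}$ and $T_i := T_{i-1}\overline{T_{i-1}}$ for $i \geq 2$; $\tau_i := |T_i| = 2^{i-1}$. An occurrence in a text $T$ is a pair of positions $(i,j)$; it is a net occurrence if $T[i\ldots j]$ occurs at least twice in $T$ while both $T[i-1\ldots j]$ and $T[i\ldots j+1]$ occur only once (when $i=1$ the left extension is taken to be unique; when $j=|T|$ the right extension is taken to be unique). -}

module Defs where

open import Data.Bool using (Bool; true; false; not)
open import Data.Bool.Properties using () renaming (_≟_ to _≟B_)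
open import Data.Nat using (ℕ; zero; suc; _+_; _∸_; _^_; _≤_)
open import Data.List using (List; []; _∷_; _++_; map; take; drop; length)
open import Data.List.Properties using (≡-dec)
open import Data.Product using (_×_)
open import Data.Sum using (_⊎_)
open import Relation.Nullary using (yes; no)
open import Relation.Binary.PropositionalEquality using (_≡_)

-- Binary strings: letter a = false, letter b = true.
Str : Set
Str = List Bool

comp : Str → Str
comp = map not

tm : ℕ → Str
tm zero    = false ∷ []
tm (suc n) = tm n ++ comp (tm n)

-- Thue–Morse word of order i (meaningful for i ≥ 1; T 0 is set to T 1, unused)
T : ℕ → Str
T i = tm (i ∸ 1)

τ : ℕ → ℕ
τ i = 2 ^ (i ∸ 1)

-- substring S[i..j] for 1-based positions (meaningful for 1 ≤ i ≤ j ≤ |S|)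
sub : Str → ℕ → ℕ → Str
sub S i j = take (suc j ∸ i) (drop (i ∸ 1) S)

-- number of (possibly overlapping) occurrences of P in S
-- counts 0-based start positions p with S[p .. p+|P|-1] = P
occAux : Str → Str → ℕ
occAux P [] with ≡-dec _≟B_ (take (length P) []) P
... | yes _ = 1
... | no  _ = 0
occAux P (c ∷ S) with ≡-dec _≟B_ (take (length P) (c ∷ S)) P
... | yes _ = suc (occAux P S)
... | no  _ = occAux P S

occ : Str → Str → ℕ
occ P S = occAux P S

-- (i , j) is a valid occurrence (pair of 1-based positions) in S
IsOcc : Str → ℕ → ℕ → Set
IsOcc S i j = (1 ≤ i) × (i ≤ j) × (j ≤ length S)

IsNetOcc : Str → ℕ → ℕ → Set
IsNetOcc S i j =
  IsOcc S i j ×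
  (2 ≤ occ (sub S i j) S) ×
  ((i ≡ 1) ⊎ (occ (sub S (i ∸ 1) j) S ≡ 1)) ×
  ((j ≡ length S) ⊎ (occ (sub S i (suc j)) S ≡ 1))

𝒫 : ℕ → List Str
𝒫 i = T (i ∸ 2) ∷ comp (T (i ∸ 2)) ∷ (T (i ∸ 4) ++ comp (T (i ∸ 3)))
      ∷ (comp (T (i ∸ 4)) ++ T (i ∸ 3)) ∷ []

-- the nine explicit net occurrences (start, end), 1-based
nineOcc : ℕ → List (ℕ × ℕ)
nineOcc i = occAt 1 L₀ ∷ occAt (τ (i ∸ 2) + τ (i ∸ 3) + 1) L₀ ∷ occAt (τ (i ∸ 1) + τ (i ∸ 2) + 1) L₀
          ∷ occAt (τ (i ∸ 2) + 1) L₀ ∷ occAt (τ (i ∸ 1) + 1) L₀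
          ∷ occAt (τ (i ∸ 3) + τ (i ∸ 4) + 1) L₁ ∷ occAt (τ (i ∸ 1) + τ (i ∸ 3) + 1) L₁
          ∷ occAt (τ (i ∸ 3) + 1) L₁ ∷ occAt (τ (i ∸ 1) + τ (i ∸ 3) + τ (i ∸ 4) + 1) L₁ ∷ []
  where
    open import Data.Product using (_,_)
    L₀ = τ (i ∸ 2)
    L₁ = τ (i ∸ 4) + τ (i ∸ 3)
    occAt : ℕ → ℕ → ℕ × ℕ
    occAt s len = s , (s + len ∸ 1)

{-# OPTIONS --safe #-}
-- Let t be the Thue–Morse sequence, so that T_{5+k} is its prefix of length 2^{4+k}. Since
-- t(2n) = t(n) and t(2n+1) = ¬t(n), the letters at positions 2n and 2n+1 are complementary, and
-- t never repeats a letter three times; hence a factor of length ≥ 4 occurs only at positions of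
-- one parity. A net occurrence of length ≥ 4 in the prefix of length 2N therefore starts at an
-- even position and has even length, and halving it gives a net occurrence in the prefix of
-- length N; conversely doubling preserves net occurrences. Every factor of length ≤ 4 of a long
-- enough prefix occurs twice, extensions included, so no net occurrence is shorter than 4. By
-- induction on k the net occurrences of T_{5+k} are those of T_5 scaled by 2^k, a finite
-- computation; the same halving argument shows that the words of 𝒫_{5+k}, which are scaled
-- factors of T_5, occur exactly at these positions.
module Submission where

open import Defs
open import Data.Bool using (Bool; true; false; not; _xor_)
open import Data.Bool.Properties using (not-injective; not-involutive; not-¬; not-distribʳ-xor; xor-identityʳ)
  renaming (_≟_ to _≟ᵇ_)
open import Data.Nat using (ℕ; zero; suc; _+_; _*_; _∸_; _^_; _<_; _≤_; z≤n; s≤s; _⊓_; ⌊_/2⌋; _≟_; _≤?_; _<?_)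
open import Data.Nat.Properties
open import Data.Nat.Tactic.RingSolver using (solve-∀)
open import Data.Empty using (⊥; ⊥-elim)
open import Data.Product using (∃; _×_; _,_; proj₁; proj₂; uncurry)
import Data.Product.Properties as Product
import Function.Properties.Equivalence as ⇔
open import Data.List using (List; []; _∷_; _++_; map; take; drop; length)
open import Data.List.Properties using (≡-dec; map-id; take-[]; drop-[]; ∷-injective)
open import Data.List.Membership.Propositional using (_∈_; find)
open import Data.List.Membership.Propositional.Properties using (∈-map⁺; ∈-map⁻)
open import Data.List.Relation.Unary.Any as Any using (Any; any?)
open import Data.List.Relation.Unary.Any.Properties using (map⁺; map⁻)
open import Data.List.Relation.Unary.All as All using (All)
open import Data.List.Membership.DecPropositional (Product.≡-dec _≟_ _≟_) using (_∈?_)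
open import Data.Sum using (_⊎_; inj₁; inj₂)
open import Data.Unit using (⊤; tt)
open import Function using (_∘_; case_of_)
open import Relation.Nullary using (¬_; Dec; yes; no; ¬?)
open import Relation.Nullary.Decidable using (map′; from-yes; _×-dec_; _⊎-dec_; _→-dec_)
open import Function.Bundles using (_⇔_; mk⇔; Equivalence)
open import Relation.Binary.PropositionalEquality

data Parity : ℕ → Set where
  even : ∀ k → Parity (2 * k)
  odd  : ∀ k → Parity (suc (2 * k))

parity : ∀ n → Parity n
parity zero = even 0
parity (suc n) with parity n
... | even k = odd k
... | odd k  = subst Parity (*-suc 2 k) (even (suc k))

2a+2b≡2[a+b] : ∀ a b → 2 * a + 2 * b ≡ 2 * (a + b)
2a+2b≡2[a+b] a b = sym (*-distribˡ-+ 2 a b)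

a+b≤n⇒2a+2b≤2n : ∀ {a b n} → a + b ≤ n → 2 * a + 2 * b ≤ 2 * n
a+b≤n⇒2a+2b≤2n {a} {b} {n} h = subst (_≤ 2 * n) (sym (2a+2b≡2[a+b] a b)) (*-monoʳ-≤ 2 h)

2a+2b≤2n⇒a+b≤n : ∀ {a b n} → 2 * a + 2 * b ≤ 2 * n → a + b ≤ n
2a+2b≤2n⇒a+b≤n {a} {b} {n} h = *-cancelˡ-≤ 2 (subst (_≤ 2 * n) (2a+2b≡2[a+b] a b) h)

2a+[1+2m]≡1+2[a+m] : ∀ a m → 2 * a + suc (2 * m) ≡ suc (2 * (a + m))
2a+[1+2m]≡1+2[a+m] a m = trans (+-suc (2 * a) (2 * m)) (cong suc (2a+2b≡2[a+b] a m))

2a+[1+2m]≤2n⇒a+[1+m]≤n : ∀ {a m n} → 2 * a + suc (2 * m) ≤ 2 * n → a + suc m ≤ n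
2a+[1+2m]≤2n⇒a+[1+m]≤n {a} {m} {n} h = subst (_≤ n) (sym (+-suc a m))
  (*-cancelˡ-< 2 (a + m) n (subst (_≤ 2 * n) (2a+[1+2m]≡1+2[a+m] a m) h))

[1+2a]+[1+2m]≡2[a+[1+m]] : ∀ a m → suc (2 * a) + suc (2 * m) ≡ 2 * (a + suc m)
[1+2a]+[1+2m]≡2[a+[1+m]] = solve-∀

2≤m⇒4≤1+2m : ∀ {m} → 2 ≤ m → 4 ≤ suc (2 * m)
2≤m⇒4≤1+2m 2≤m = ≤-trans (*-monoʳ-≤ 2 2≤m) (n≤1+n _)

j<m⇒2j<n : ∀ {j m n} → 2 * m ≤ suc n → j < m → 2 * j < n
j<m⇒2j<n {j} {m} 2m≤1+n j<m = ≤-pred (≤-trans (subst (_≤ 2 * m) (*-suc 2 j) (*-monoʳ-≤ 2 j<m)) 2m≤1+n)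

2m≤6⇒m≤4 : ∀ {m} → 2 * m ≤ 6 → m ≤ 4
2m≤6⇒m≤4 {m} 2m≤6 = ≤-trans (*-cancelˡ-≤ {m} {3} 2 2m≤6) (n≤1+n 3)

c*[2s]≡2[c*s] : ∀ c s → c * (2 * s) ≡ 2 * (c * s)
c*[2s]≡2[c*s] c s = trans (sym (*-assoc c 2 s)) (trans (cong (_* s) (*-comm c 2)) (*-assoc 2 c s))

isOdd : ℕ → Bool
isOdd zero          = false
isOdd (suc zero)    = true
isOdd (suc (suc n)) = isOdd n

isOdd-even : ∀ k → isOdd (2 * k) ≡ false
isOdd-even zero    = refl
isOdd-even (suc k) rewrite *-suc 2 k = isOdd-even k

isOdd-odd : ∀ k → isOdd (suc (2 * k)) ≡ true
isOdd-odd zero    = refl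
isOdd-odd (suc k) = trans (cong (λ n → isOdd (suc n)) (*-suc 2 k)) (isOdd-odd k)

⌊2k/2⌋≡k : ∀ k → ⌊ 2 * k /2⌋ ≡ k
⌊2k/2⌋≡k zero    = refl
⌊2k/2⌋≡k (suc k) rewrite *-suc 2 k = cong suc (⌊2k/2⌋≡k k)

⌊1+2k/2⌋≡k : ∀ k → ⌊ suc (2 * k) /2⌋ ≡ k
⌊1+2k/2⌋≡k zero    = refl
⌊1+2k/2⌋≡k (suc k) = trans (cong (λ n → ⌊ suc n /2⌋) (*-suc 2 k)) (cong suc (⌊1+2k/2⌋≡k k))

-- With fuel f ≥ n this is the parity of the binary digit sum of n, i.e. letter n of the Thue–Morse sequence.
digitSumParity : ℕ → ℕ → Bool
digitSumParity zero    n = false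
digitSumParity (suc f) n = isOdd n xor digitSumParity f ⌊ n /2⌋

t : ℕ → Bool
t n = digitSumParity n n

digitSumParity-0 : ∀ f → digitSumParity f 0 ≡ false
digitSumParity-0 zero    = refl
digitSumParity-0 (suc f) = digitSumParity-0 f

digitSumParity-stable : ∀ {f g} n → n ≤ f → n ≤ g → digitSumParity f n ≡ digitSumParity g n
digitSumParity-stable {f} {g} zero _ _ = trans (digitSumParity-0 f) (sym (digitSumParity-0 g))
digitSumParity-stable (suc n) (s≤s n≤f) (s≤s n≤g) =
  cong (isOdd (suc n) xor_) (digitSumParity-stable ⌊ suc n /2⌋ (≤-trans half≤n n≤f) (≤-trans half≤n n≤g))
  where
  half≤n : ⌊ suc n /2⌋ ≤ n
  half≤n = ≤-pred (⌊n/2⌋<n n)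

t-unfold : ∀ n → t n ≡ isOdd n xor t ⌊ n /2⌋
t-unfold zero    = refl
t-unfold (suc n) = cong (isOdd (suc n) xor_) (digitSumParity-stable ⌊ suc n /2⌋ (≤-pred (⌊n/2⌋<n n)) ≤-refl)

t-double : ∀ k → t (2 * k) ≡ t k
t-double k rewrite t-unfold (2 * k) | isOdd-even k | ⌊2k/2⌋≡k k = refl

t-double+1 : ∀ k → t (suc (2 * k)) ≡ not (t k)
t-double+1 k rewrite t-unfold (suc (2 * k)) | isOdd-odd k | ⌊1+2k/2⌋≡k k = refl

t-block : ∀ k c {j} → j < 2 ^ k → t (c * 2 ^ k + j) ≡ t c xor t j
t-block zero c {zero} _ rewrite *-identityʳ c | +-identityʳ c = sym (xor-identityʳ (t c))
t-block zero c {suc j} (s≤s ())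
t-block (suc k) c {j} j<2s with parity j
... | even i = begin
  t (c * (2 * s) + 2 * i)  ≡⟨ cong t (regroup c s i) ⟩
  t (2 * (c * s + i))      ≡⟨ t-double (c * s + i) ⟩
  t (c * s + i)            ≡⟨ t-block k c (*-cancelˡ-< 2 i s j<2s) ⟩
  t c xor t i              ≡⟨ cong (t c xor_) (t-double i) ⟨
  t c xor t (2 * i)        ∎
  where
  s : ℕ
  s = 2 ^ k
  open ≡-Reasoning
  regroup : ∀ c s i → c * (2 * s) + 2 * i ≡ 2 * (c * s + i)
  regroup = solve-∀
... | odd i = begin
  t (c * (2 * s) + suc (2 * i))  ≡⟨ cong t (regroup c s i) ⟩
  t (suc (2 * (c * s + i)))      ≡⟨ t-double+1 (c * s + i) ⟩
  not (t (c * s + i))            ≡⟨ cong not (t-block k c (*-cancelˡ-< 2 i s (<-trans (n<1+n _) j<2s))) ⟩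
  not (t c xor t i)              ≡⟨ not-distribʳ-xor (t c) (t i) ⟩
  t c xor not (t i)              ≡⟨ cong (t c xor_) (t-double+1 i) ⟨
  t c xor t (suc (2 * i))        ∎
  where
  s : ℕ
  s = 2 ^ k
  open ≡-Reasoning
  regroup : ∀ c s i → c * (2 * s) + suc (2 * i) ≡ suc (2 * (c * s + i))
  regroup = solve-∀

t-double-+ : ∀ a j → t (2 * a + 2 * j) ≡ t (a + j)
t-double-+ a j = trans (cong t (2a+2b≡2[a+b] a j)) (t-double (a + j))

t-double-+-suc : ∀ a j → t (suc (2 * a + 2 * j)) ≡ not (t (a + j))
t-double-+-suc a j = trans (cong (λ n → t (suc n)) (2a+2b≡2[a+b] a j)) (t-double+1 (a + j))

t-noTripleRun : ∀ m → t m ≡ t (suc m) → t (suc m) ≡ t (suc (suc m)) → ⊥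
t-noTripleRun m p q with parity m
... | even c = not-¬ refl (trans (sym (t-double c)) (trans p (t-double+1 c)))
... | odd c  = not-¬ refl (begin
  t (suc c)                    ≡⟨ t-double (suc c) ⟨
  t (2 * suc c)                ≡⟨ cong t (*-suc 2 c) ⟩
  t (suc (suc (2 * c)))        ≡⟨ q ⟩
  t (suc (suc (suc (2 * c))))  ≡⟨ cong (λ n → t (suc n)) (*-suc 2 c) ⟨
  t (suc (2 * suc c))          ≡⟨ t-double+1 (suc c) ⟩
  not (t (suc c))              ∎)
  where open ≡-Reasoning

t-pair : ∀ c → t (2 * c) ≡ not (t (suc (2 * c)))
t-pair c = trans (t-double c) (trans (sym (not-involutive (t c))) (cong not (sym (t-double+1 c))))

record Agree (x y L : ℕ) : Set where
  constructor agree
  field at : ∀ {k} → k < L → t (x + k) ≡ t (y + k)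
open Agree public

Agree-refl : ∀ x L → Agree x x L
Agree-refl x L = agree λ _ → refl

Agree-sym : ∀ {x y L} → Agree x y L → Agree y x L
Agree-sym e = agree λ k<L → sym (at e k<L)

Agree-prefix : ∀ {x y L M} → M ≤ L → Agree x y L → Agree x y M
Agree-prefix M≤L e = agree λ k<M → at e (<-≤-trans k<M M≤L)

Agree-tail : ∀ {x y L} → Agree x y (suc L) → Agree (suc x) (suc y) L
Agree-tail {x} {y} e = agree λ {k} k<L →
  trans (cong t (sym (+-suc x k))) (trans (at e (s≤s k<L)) (cong t (+-suc y k)))

Agree-head : ∀ {x y L} → 0 < L → Agree x y L → t x ≡ t y
Agree-head {x} {y} 0<L e = trans (cong t (sym (+-identityʳ x))) (trans (at e 0<L) (cong t (+-identityʳ y)))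

Agree-cons : ∀ {x y L} → t x ≡ t y → Agree (suc x) (suc y) L → Agree x y (suc L)
Agree-cons {x} {y} {L} head tail = agree go
  where
  go : ∀ {k} → k < suc L → t (x + k) ≡ t (y + k)
  go {zero}  _         = trans (cong t (+-identityʳ x)) (trans head (cong t (sym (+-identityʳ y))))
  go {suc k} (s≤s k<L) = trans (cong t (+-suc x k)) (trans (at tail k<L) (cong t (sym (+-suc y k))))

Agree-snoc : ∀ {x y L} → Agree x y L → t (x + L) ≡ t (y + L) → Agree x y (suc L)
Agree-snoc {x} {y} {L} e last = agree λ {k} k<1+L → case k <? L of λ where
  (yes k<L) → at e k<L
  (no k≮L)  → subst (λ i → t (x + i) ≡ t (y + i)) (≤-antisym (≮⇒≥ k≮L) (≤-pred k<1+L)) last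

Agree-double : ∀ {a b M} → Agree a b M → Agree (2 * a) (2 * b) (2 * M)
Agree-double {a} {b} {M} e = agree λ {k} k<2M → go k k<2M
  where
  go : ∀ k → k < 2 * M → t (2 * a + k) ≡ t (2 * b + k)
  go k k<2M with parity k
  ... | even j = trans (t-double-+ a j) (trans (at e (*-cancelˡ-< 2 j M k<2M)) (sym (t-double-+ b j)))
  ... | odd j  = begin
    t (2 * a + suc (2 * j))  ≡⟨ cong t (+-suc (2 * a) (2 * j)) ⟩
    t (suc (2 * a + 2 * j))  ≡⟨ t-double-+-suc a j ⟩
    not (t (a + j))          ≡⟨ cong not (at e (*-cancelˡ-< 2 j M (<-trans (n<1+n _) k<2M))) ⟩
    not (t (b + j))          ≡⟨ t-double-+-suc b j ⟨
    t (suc (2 * b + 2 * j))  ≡⟨ cong t (+-suc (2 * b) (2 * j)) ⟨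
    t (2 * b + suc (2 * j))  ∎
    where open ≡-Reasoning

Agree-halve : ∀ {a b M L} → 2 * M ≤ suc L → Agree (2 * a) (2 * b) L → Agree a b M
Agree-halve {a} {b} 2M≤1+L e = agree λ {j} j<M →
  trans (sym (t-double-+ a j)) (trans (at e (j<m⇒2j<n 2M≤1+L j<M)) (t-double-+ b j))

Agree-halve-odd : ∀ {a b M L} → 2 * M ≤ suc L → Agree (suc (2 * a)) (suc (2 * b)) L → Agree a b M
Agree-halve-odd {a} {b} 2M≤1+L e = agree λ {j} j<M → not-injective
  (trans (sym (t-double-+-suc a j)) (trans (at e (j<m⇒2j<n 2M≤1+L j<M)) (t-double-+-suc b j)))

-- Read from an even position the factor is a sequence of complementary pairs; read from the odd
-- position 2b+1 the same pairs would force t b = t (b+1) = t (b+2).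
even-odd-clash : ∀ {a b L} → 4 ≤ L → Agree (2 * a) (suc (2 * b)) L → ⊥
even-odd-clash {a} {b} {L} 4≤L e = t-noTripleRun b (step 0 (≤-trans (s≤s (s≤s z≤n)) 4≤L)) (step 1 4≤L)
  where
  open ≡-Reasoning
  odd-index : ∀ j → suc (2 * b) + 2 * j ≡ suc (2 * (j + b))
  odd-index j = cong suc (trans (2a+2b≡2[a+b] b j) (cong (2 *_) (+-comm b j)))
  even-index : ∀ j → suc (2 * b) + suc (2 * j) ≡ 2 * (suc j + b)
  even-index j = trans ([1+2a]+[1+2m]≡2[a+[1+m]] b j) (cong (2 *_) (+-comm b (suc j)))
  step : ∀ j → suc (2 * j) < L → t (j + b) ≡ t (suc j + b)
  step j 2j+1<L = begin
    t (j + b)                       ≡⟨ not-involutive (t (j + b)) ⟨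
    not (not (t (j + b)))           ≡⟨ cong not (trans (cong t (odd-index j)) (t-double+1 (j + b))) ⟨
    not (t (suc (2 * b) + 2 * j))   ≡⟨ cong not (at e (<-trans (n<1+n _) 2j+1<L)) ⟨
    not (t (2 * a + 2 * j))         ≡⟨ cong not (t-double-+ a j) ⟩
    not (t (a + j))                 ≡⟨ t-double-+-suc a j ⟨
    t (suc (2 * a + 2 * j))         ≡⟨ cong t (+-suc (2 * a) (2 * j)) ⟨
    t (2 * a + suc (2 * j))         ≡⟨ at e 2j+1<L ⟩
    t (suc (2 * b) + suc (2 * j))   ≡⟨ cong t (even-index j) ⟩
    t (2 * (suc j + b))             ≡⟨ t-double (suc j + b) ⟩
    t (suc j + b)                   ∎

Agree-even : ∀ {a y L} → 4 ≤ L → Agree (2 * a) y L → ∃ λ b → y ≡ 2 * b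
Agree-even {a} {y} 4≤L e with parity y
... | even b = b , refl
... | odd b  = ⊥-elim (even-odd-clash {a} {b} 4≤L e)

Agree-odd : ∀ {a y L} → 4 ≤ L → Agree (suc (2 * a)) y L → ∃ λ b → y ≡ suc (2 * b)
Agree-odd {a} {y} 4≤L e with parity y
... | even b = ⊥-elim (even-odd-clash {b} {a} 4≤L (Agree-sym e))
... | odd b  = b , refl

-- Occurrences inside the prefix t[0 .. N-1], with 0-based start p and length L.
Repeats : ℕ → ℕ → ℕ → Set
Repeats N p L = ∃ λ q → q ≢ p × q + L ≤ N × Agree p q L

OccursOnce : ℕ → ℕ → ℕ → Set
OccursOnce N p L = ∀ q → q + L ≤ N → Agree p q L → q ≡ p

LeftMaximal : ℕ → ℕ → ℕ → Set
LeftMaximal N zero    L = ⊤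
LeftMaximal N (suc p) L = OccursOnce N p (suc L)

RightMaximal : ℕ → ℕ → ℕ → Set
RightMaximal N p L = p + L ≡ N ⊎ OccursOnce N p (suc L)

record IsNet (N p L : ℕ) : Set where
  constructor net
  field
    within       : p + L ≤ N
    repeats      : Repeats N p L
    leftMaximal  : LeftMaximal N p L
    rightMaximal : RightMaximal N p L

Repeats-double : ∀ {N a M} → Repeats N a M → Repeats (2 * N) (2 * a) (2 * M)
Repeats-double {N} {a} {M} (b , b≢a , fits , e) =
  2 * b , b≢a ∘ *-cancelˡ-≡ b a 2 , a+b≤n⇒2a+2b≤2n {b} {M} {N} fits , Agree-double e

Repeats-halve : ∀ {N a M} → 4 ≤ 2 * M → Repeats (2 * N) (2 * a) (2 * M) → Repeats N a M
Repeats-halve {N} {a} {M} 4≤2M (q , q≢p , fits , e) with Agree-even {a} 4≤2M e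
... | b , refl = b , q≢p ∘ cong (2 *_) , 2a+2b≤2n⇒a+b≤n {b} {M} {N} fits , Agree-halve (n≤1+n _) e

OccursOnce-double : ∀ {N a M} → 2 ≤ M → OccursOnce N a (suc M) → OccursOnce (2 * N) (2 * a) (suc (2 * M))
OccursOnce-double {N} {a} {M} 2≤M once q fits e with Agree-even {a} (2≤m⇒4≤1+2m 2≤M) e
... | b , refl = cong (2 *_) (once b (2a+[1+2m]≤2n⇒a+[1+m]≤n fits) (Agree-halve (≤-reflexive (*-suc 2 M)) e))

OccursOnce-double-odd : ∀ {N a M} → 2 ≤ M → OccursOnce N a (suc M) → OccursOnce (2 * N) (suc (2 * a)) (suc (2 * M))
OccursOnce-double-odd {N} {a} {M} 2≤M once q fits e with Agree-odd {a} (2≤m⇒4≤1+2m 2≤M) e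
... | b , refl = cong (λ c → suc (2 * c))
  (once b (*-cancelˡ-≤ 2 (subst (_≤ 2 * N) ([1+2a]+[1+2m]≡2[a+[1+m]] b M) fits)) (Agree-halve-odd (≤-reflexive (*-suc 2 M)) e))

OccursOnce-halve : ∀ {N a M} → OccursOnce (2 * N) (2 * a) (suc (2 * M)) → OccursOnce N a (suc M)
OccursOnce-halve {N} {a} {M} once b fits e =
  *-cancelˡ-≡ b a 2 (once (2 * b) (≤-trans (+-monoʳ-≤ (2 * b) 1+2M≤2+2M) (a+b≤n⇒2a+2b≤2n {b} {suc M} {N} fits))
                                  (Agree-prefix 1+2M≤2+2M (Agree-double e)))
  where
  1+2M≤2+2M : suc (2 * M) ≤ 2 * suc M
  1+2M≤2+2M = ≤-trans (n≤1+n _) (≤-reflexive (sym (*-suc 2 M)))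

OccursOnce-halve-odd : ∀ {N a M} → OccursOnce (2 * N) (suc (2 * a)) (suc (2 * M)) → OccursOnce N a (suc M)
OccursOnce-halve-odd {N} {a} {M} once b fits e =
  *-cancelˡ-≡ b a 2 (suc-injective (once (suc (2 * b)) (subst (_≤ 2 * N) (sym ([1+2a]+[1+2m]≡2[a+[1+m]] b M)) (*-monoʳ-≤ 2 fits))
                                                      (Agree-tail (subst (Agree (2 * a) (2 * b)) (*-suc 2 M) (Agree-double e)))))

LeftMaximal-double : ∀ {N a M} → 2 ≤ M → LeftMaximal N a M → LeftMaximal (2 * N) (2 * a) (2 * M)
LeftMaximal-double {a = zero}   2≤M _    = tt
LeftMaximal-double {N} {suc a} {M} 2≤M once =
  subst (λ p → LeftMaximal (2 * N) p (2 * M)) (sym (*-suc 2 a)) (OccursOnce-double-odd 2≤M once)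

LeftMaximal-halve : ∀ {N a M} → LeftMaximal (2 * N) (2 * a) (2 * M) → LeftMaximal N a M
LeftMaximal-halve {a = zero}   _    = tt
LeftMaximal-halve {N} {suc a} {M} once =
  OccursOnce-halve-odd (subst (λ p → LeftMaximal (2 * N) p (2 * M)) (*-suc 2 a) once)

RightMaximal-double : ∀ {N a M} → 2 ≤ M → RightMaximal N a M → RightMaximal (2 * N) (2 * a) (2 * M)
RightMaximal-double {a = a} {M} _   (inj₁ ends) = inj₁ (trans (2a+2b≡2[a+b] a M) (cong (2 *_) ends))
RightMaximal-double             2≤M (inj₂ once) = inj₂ (OccursOnce-double 2≤M once)

RightMaximal-halve : ∀ {N a M} → RightMaximal (2 * N) (2 * a) (2 * M) → RightMaximal N a M
RightMaximal-halve {N} {a} {M} (inj₁ ends) = inj₁ (*-cancelˡ-≡ (a + M) N 2 (trans (sym (2a+2b≡2[a+b] a M)) ends))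
RightMaximal-halve             (inj₂ once) = inj₂ (OccursOnce-halve once)

IsNet-double : ∀ {N a M} → 2 ≤ M → IsNet N a M → IsNet (2 * N) (2 * a) (2 * M)
IsNet-double {N} {a} {M} 2≤M (net within repeats left right) =
  net (a+b≤n⇒2a+2b≤2n {a} {M} {N} within) (Repeats-double repeats) (LeftMaximal-double 2≤M left) (RightMaximal-double 2≤M right)

-- At an odd start 2c+1 the preceding letter is forced to be ¬ t (2c+1), so the left extension repeats too.
IsNet⇒even-start : ∀ {N p L} → 4 ≤ L → IsNet (2 * N) p L → ∃ λ a → p ≡ 2 * a
IsNet⇒even-start {N} {p} {L} 4≤L n with parity p
... | even a = a , refl
... | odd c with IsNet.repeats n
...   | q , q≢p , fits , e with Agree-odd {c} 4≤L e
...     | d , refl = ⊥-elim (q≢p (cong suc (IsNet.leftMaximal n (2 * d) fits′ e′)))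
  where
  fits′ : 2 * d + suc L ≤ 2 * N
  fits′ = subst (_≤ 2 * N) (sym (+-suc (2 * d) L)) fits
  first : t (2 * c) ≡ t (2 * d)
  first = trans (t-pair c) (trans (cong not (Agree-head (≤-trans (s≤s z≤n) 4≤L) e)) (sym (t-pair d)))
  e′ : Agree (2 * c) (2 * d) (suc L)
  e′ = Agree-cons first e

-- With odd length the last letter opens a complementary pair, so the right extension repeats too.
IsNet⇒even-length : ∀ {N a L} → 4 ≤ L → IsNet (2 * N) (2 * a) L → ∃ λ M → L ≡ 2 * M
IsNet⇒even-length {N} {a} {L} 4≤L n with parity L
... | even M = M , refl
... | odd M with IsNet.repeats n
...   | q , q≢p , fits , e with Agree-even {a} 4≤L e
...     | b , refl = ⊥-elim (case IsNet.rightMaximal n of λ where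
  (inj₁ ends) → odd-end≢2N a (sym ends)
  (inj₂ once) → q≢p (once (2 * b) fits′ (Agree-snoc e last)))
  where
  odd-end≢2N : ∀ c → 2 * N ≢ 2 * c + suc (2 * M)
  odd-end≢2N c eq = even≢odd N (c + M) (trans eq (2a+[1+2m]≡1+2[a+m] c M))
  fits′ : 2 * b + suc (suc (2 * M)) ≤ 2 * N
  fits′ = subst (_≤ 2 * N) (sym (+-suc (2 * b) (suc (2 * M)))) (≤∧≢⇒< fits (odd-end≢2N b ∘ sym))
  last : t (2 * a + suc (2 * M)) ≡ t (2 * b + suc (2 * M))
  last = begin
    t (2 * a + suc (2 * M))   ≡⟨ cong t (2a+[1+2m]≡1+2[a+m] a M) ⟩
    t (suc (2 * (a + M)))     ≡⟨ t-double+1 (a + M) ⟩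
    not (t (a + M))           ≡⟨ cong not (at (Agree-halve {a} {b} (≤-reflexive (*-suc 2 M)) e) ≤-refl) ⟩
    not (t (b + M))           ≡⟨ t-double+1 (b + M) ⟨
    t (suc (2 * (b + M)))     ≡⟨ cong t (2a+[1+2m]≡1+2[a+m] b M) ⟨
    t (2 * b + suc (2 * M))   ∎
    where open ≡-Reasoning

IsNet-halve : ∀ {N p L} → 4 ≤ L → IsNet (2 * N) p L →
              ∃ λ a → ∃ λ M → p ≡ 2 * a × L ≡ 2 * M × IsNet N a M
IsNet-halve {N} {p} {L} 4≤L n with IsNet⇒even-start {N} {p} 4≤L n
... | a , refl with IsNet⇒even-length {N} {a} 4≤L n
... | M , refl = a , M , refl , refl ,
  net (2a+2b≤2n⇒a+b≤n {a} {M} within) (Repeats-halve 4≤L repeats) (LeftMaximal-halve leftMaximal) (RightMaximal-halve rightMaximal)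
  where open IsNet n

ShortFactorsRepeat : ℕ → Set
ShortFactorsRepeat N = ∀ p L → L ≤ 4 → p + L ≤ N → Repeats N p L

short-not-net : ∀ {N p L} → ShortFactorsRepeat N → 4 ≤ N → L ≤ 3 → ¬ IsNet N p L
short-not-net {N} {suc p} {L} short _ L≤3 (net within _ once _)
  with short p (suc L) (s≤s L≤3) (subst (_≤ N) (sym (+-suc p L)) within)
... | q , q≢p , fits , e = q≢p (once q fits e)
short-not-net {N} {zero} {L} short 4≤N L≤3 (net _ _ _ (inj₁ L≡N)) = 1+n≰n (≤-trans 4≤N (subst (_≤ 3) L≡N L≤3))
short-not-net {N} {zero} {L} short 4≤N L≤3 (net _ _ _ (inj₂ once))
  with short 0 (suc L) (s≤s L≤3) (≤-trans (s≤s L≤3) 4≤N)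
... | q , q≢0 , fits , e = q≢0 (once q fits e)

half-cover : ∀ a u N → 2 * a + u ≤ 2 * N → ∃ λ M → u ≤ 2 * M × 2 * M ≤ suc u × a + M ≤ N
half-cover a u N fits with parity u
... | even v = v , ≤-refl , n≤1+n _ , 2a+2b≤2n⇒a+b≤n {a} {v} fits
... | odd v  = suc v , ≤-trans (n≤1+n _) (≤-reflexive (sym (*-suc 2 v))) , ≤-reflexive (*-suc 2 v) , 2a+[1+2m]≤2n⇒a+[1+m]≤n fits

ShortFactorsRepeat-double : ∀ {N} → ShortFactorsRepeat N → ShortFactorsRepeat (2 * N)
ShortFactorsRepeat-double {N} short p L L≤4 fits with parity p
... | even a with half-cover a L N fits
...   | M , L≤2M , 2M≤1+L , fitsM with short a M (2m≤6⇒m≤4 (≤-trans 2M≤1+L (s≤s (≤-trans L≤4 (n≤1+n 4))))) fitsM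
...     | b , b≢a , fitsb , e =
  2 * b , b≢a ∘ *-cancelˡ-≡ b a 2 , ≤-trans (+-monoʳ-≤ (2 * b) L≤2M) (a+b≤n⇒2a+2b≤2n {b} {M} fitsb) ,
  Agree-prefix L≤2M (Agree-double e)
ShortFactorsRepeat-double {N} short p L L≤4 fits | odd a
  with half-cover a (suc L) N (subst (_≤ 2 * N) (sym (+-suc (2 * a) L)) fits)
...   | M , 1+L≤2M , 2M≤2+L , fitsM with short a M (2m≤6⇒m≤4 (≤-trans 2M≤2+L (s≤s (s≤s L≤4)))) fitsM
...     | b , b≢a , fitsb , e =
  suc (2 * b) , b≢a ∘ *-cancelˡ-≡ b a 2 ∘ suc-injective ,
  subst (_≤ 2 * N) (+-suc (2 * b) L) (≤-trans (+-monoʳ-≤ (2 * b) 1+L≤2M) (a+b≤n⇒2a+2b≤2n {b} {M} fitsb)) ,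
  Agree-tail (Agree-prefix 1+L≤2M (Agree-double e))

Agree? : ∀ x y L → Dec (Agree x y L)
Agree? x y L = map′ agree at (allUpTo? (λ k → t (x + k) ≟ᵇ t (y + k)) L)

Repeats? : ∀ N p L → Dec (Repeats N p L)
Repeats? N p L = map′ (λ (q , _ , r) → q , r) (λ (q , q≢p , fits , e) → q , s≤s (m+n≤o⇒m≤o q fits) , q≢p , fits , e)
  (anyUpTo? (λ q → ¬? (q ≟ p) ×-dec (q + L ≤? N) ×-dec Agree? p q L) (suc N))

OccursOnce? : ∀ N p L → Dec (OccursOnce N p L)
OccursOnce? N p L = map′ (λ once q fits → once (s≤s (m+n≤o⇒m≤o q fits)) fits) (λ once {q} _ → once q)
  (allUpTo? (λ q → (q + L ≤? N) →-dec (Agree? p q L →-dec (q ≟ p))) (suc N))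

IsNet? : ∀ N p L → Dec (IsNet N p L)
IsNet? N p L = map′ (λ (w , r , l , m) → net w r l m) (λ (net w r l m) → w , r , l , m)
  ((p + L ≤? N) ×-dec Repeats? N p L ×-dec leftMaximal? p ×-dec ((p + L ≟ N) ⊎-dec OccursOnce? N p (suc L)))
  where
  leftMaximal? : ∀ p → Dec (LeftMaximal N p L)
  leftMaximal? zero    = yes tt
  leftMaximal? (suc p) = OccursOnce? N p (suc L)

allWithin? : ∀ {P : ℕ → ℕ → Set} → (∀ p L → Dec (P p L)) → ∀ N → Dec (∀ {p L} → p + L ≤ N → P p L)
allWithin? P? N = map′
  (λ all {p} {L} fits → all (s≤s (m+n≤o⇒m≤o p fits)) (s≤s (m+n≤o⇒n≤o p fits)) fits)
  (λ all {p} _ {L} _ → all {p} {L})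
  (allUpTo? (λ p → allUpTo? (λ L → (p + L ≤? N) →-dec P? p L) (suc N)) (suc N))

shortFactorsRepeat : ∀ k → ShortFactorsRepeat (2 ^ (5 + k))
shortFactorsRepeat zero p L L≤4 fits = from-yes (allWithin? (λ p L → (L ≤? 4) →-dec Repeats? 32 p L) 32) fits L≤4
shortFactorsRepeat (suc k) = ShortFactorsRepeat-double (shortFactorsRepeat k)

scale : ℕ → ℕ × ℕ → ℕ × ℕ
scale s (c , d) = c * s , d * s

-- The net occurrences (start, length) of T₅ = t[0 .. 15]; in T_{5+k} all of them are scaled by 2^k.
netUnits : List (ℕ × ℕ)
netUnits = (0 , 4) ∷ (6 , 4) ∷ (12 , 4) ∷ (4 , 4) ∷ (8 , 4) ∷ (3 , 3) ∷ (10 , 3) ∷ (2 , 3) ∷ (11 , 3) ∷ []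

netOccurrences : ℕ → List (ℕ × ℕ)
netOccurrences s = map (scale s) netUnits

∈-scale-double : ∀ {us s a M} → (a , M) ∈ map (scale s) us → (2 * a , 2 * M) ∈ map (scale (2 * s)) us
∈-scale-double {us} {s} m with ∈-map⁻ (scale s) m
... | (c , d) , u∈us , refl =
  subst (_∈ map (scale (2 * s)) us) (cong₂ _,_ (c*[2s]≡2[c*s] c s) (c*[2s]≡2[c*s] d s)) (∈-map⁺ (scale (2 * s)) u∈us)

∈-scale-halve : ∀ {us s p L} → (p , L) ∈ map (scale (2 * s)) us →
                ∃ λ a → ∃ λ M → p ≡ 2 * a × L ≡ 2 * M × (a , M) ∈ map (scale s) us
∈-scale-halve {s = s} m with ∈-map⁻ (scale (2 * s)) m
... | (c , d) , u∈us , refl = c * s , d * s , c*[2s]≡2[c*s] c s , c*[2s]≡2[c*s] d s , ∈-map⁺ (scale s) u∈us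

netUnits-bounds : All (λ (c , d) → 3 ≤ d × c + d ≤ 16) netUnits
netUnits-bounds = from-yes (All.all? (λ (c , d) → (3 ≤? d) ×-dec (c + d ≤? 16)) netUnits)

∈-netOccurrences-bounds : ∀ {s p L} → 1 ≤ s → (p , L) ∈ netOccurrences s → 3 ≤ L × p + L ≤ 16 * s
∈-netOccurrences-bounds {s} 1≤s m with ∈-map⁻ (scale s) {xs = netUnits} m
... | (c , d) , u∈us , refl with All.lookup netUnits-bounds u∈us
... | 3≤d , c+d≤16 =
  ≤-trans 3≤d (≤-trans (≤-reflexive (sym (*-identityʳ d))) (*-monoʳ-≤ d 1≤s)) ,
  subst (_≤ 16 * s) (*-distribʳ-+ s c d) (*-monoˡ-≤ s c+d≤16)

net-characterisation : ∀ k p L → IsNet (2 ^ (4 + k)) p L ⇔ (p , L) ∈ netOccurrences (2 ^ k)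
net-characterisation zero p L = mk⇔
  (λ n → proj₁ (base (IsNet.within n)) n)
  (λ m → proj₂ (base (proj₂ (∈-netOccurrences-bounds ≤-refl m))) m)
  where
  base : p + L ≤ 16 → (IsNet 16 p L → (p , L) ∈ netOccurrences 1) × ((p , L) ∈ netOccurrences 1 → IsNet 16 p L)
  base = from-yes (allWithin? (λ p L →
    (IsNet? 16 p L →-dec ((p , L) ∈? netOccurrences 1)) ×-dec (((p , L) ∈? netOccurrences 1) →-dec IsNet? 16 p L)) 16)
net-characterisation (suc k) p L = mk⇔ to from
  where
  N : ℕ
  N = 2 ^ (4 + k)
  to : IsNet (2 * N) p L → (p , L) ∈ netOccurrences (2 * 2 ^ k)
  to n with L ≤? 3
  ... | yes L≤3 = ⊥-elim (short-not-net (shortFactorsRepeat k) (^-monoʳ-≤ 2 {2} {5 + k} (s≤s (s≤s z≤n))) L≤3 n)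
  ... | no L≰3 with IsNet-halve {N} (≰⇒> L≰3) n
  ...   | a , M , refl , refl , n′ = ∈-scale-double {netUnits} {2 ^ k} (Equivalence.to (net-characterisation k a M) n′)
  from : (p , L) ∈ netOccurrences (2 * 2 ^ k) → IsNet (2 * N) p L
  from m with ∈-scale-halve {netUnits} {2 ^ k} m
  ... | a , M , refl , refl , m′ =
    IsNet-double (≤-trans (n≤1+n 2) (proj₁ (∈-netOccurrences-bounds (m^n>0 2 k) m′))) (Equivalence.from (net-characterisation k a M) m′)

-- The words of 𝒫_{5+k} as factors (start, length) of t, in units of 2^k.
patternUnits : List (ℕ × ℕ)
patternUnits = (0 , 4) ∷ (4 , 4) ∷ (3 , 3) ∷ (2 , 3) ∷ []

PatternAt : ℕ → ℕ → ℕ → Set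
PatternAt s p L = Any (λ (c , d) → L ≡ d * s × Agree p (c * s) L) patternUnits

PatternAt? : ∀ s p L → Dec (PatternAt s p L)
PatternAt? s p L = any? (λ (c , d) → (L ≟ d * s) ×-dec Agree? p (c * s) L) patternUnits

PatternAt-double : ∀ {s a M} → PatternAt s a M → PatternAt (2 * s) (2 * a) (2 * M)
PatternAt-double {s} {a} {M} = Any.map λ { {c , d} → double c d }
  where
  double : ∀ c d → M ≡ d * s × Agree a (c * s) M → 2 * M ≡ d * (2 * s) × Agree (2 * a) (c * (2 * s)) (2 * M)
  double c d (M≡ds , e) = trans (cong (2 *_) M≡ds) (sym (c*[2s]≡2[c*s] d s)) ,
                          subst (λ y → Agree (2 * a) y (2 * M)) (sym (c*[2s]≡2[c*s] c s)) (Agree-double e)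

net⇒PatternAt : ∀ k {p L} → (p , L) ∈ netOccurrences (2 ^ k) → PatternAt (2 ^ k) p L
net⇒PatternAt zero m = All.lookup (from-yes (All.all? (λ (p , L) → PatternAt? 1 p L) (netOccurrences 1))) m
net⇒PatternAt (suc k) m with ∈-scale-halve {netUnits} {2 ^ k} m
... | a , M , refl , refl , m′ = PatternAt-double (net⇒PatternAt k m′)

PatternAt-halve : ∀ {s a M} → PatternAt (2 * s) (2 * a) (2 * M) → PatternAt s a M
PatternAt-halve {s} {a} {M} = Any.map λ { {c , d} → halve c d }
  where
  halve : ∀ c d → 2 * M ≡ d * (2 * s) × Agree (2 * a) (c * (2 * s)) (2 * M) → M ≡ d * s × Agree a (c * s) M
  halve c d (2M≡ , e) = *-cancelˡ-≡ M (d * s) 2 (trans 2M≡ (c*[2s]≡2[c*s] d s)) ,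
                        Agree-halve (n≤1+n _) (subst (λ y → Agree (2 * a) y (2 * M)) (c*[2s]≡2[c*s] c s) e)

pattern-length≥4 : ∀ {s c d} → 1 ≤ s → (c , d) ∈ patternUnits → 4 ≤ d * (2 * s)
pattern-length≥4 {s} {c} {d} 1≤s u∈ = ≤-trans (n≤1+n _) (≤-trans (n≤1+n _) (*-mono-≤ 3≤d (*-monoʳ-≤ 2 1≤s)))
  where
  3≤d : 3 ≤ d
  3≤d = All.lookup (from-yes (All.all? (λ (c , d) → 3 ≤? d) patternUnits)) u∈

PatternAt-even : ∀ {s p L} → 1 ≤ s → PatternAt (2 * s) p L → ∃ λ a → ∃ λ M → p ≡ 2 * a × L ≡ 2 * M
PatternAt-even {s} {p} 1≤s pat with find pat
... | (c , d) , u∈ , refl , e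
  with Agree-even {c * s} (pattern-length≥4 1≤s u∈) (Agree-sym (subst (λ y → Agree p y (d * (2 * s))) (c*[2s]≡2[c*s] c s) e))
... | a , refl = a , d * s , refl , c*[2s]≡2[c*s] d s

PatternAt⇒net : ∀ k {p L} → p + L ≤ 2 ^ (4 + k) → PatternAt (2 ^ k) p L → (p , L) ∈ netOccurrences (2 ^ k)
PatternAt⇒net zero = from-yes (allWithin? (λ p L → PatternAt? 1 p L →-dec ((p , L) ∈? netOccurrences 1)) 16)
PatternAt⇒net (suc k) fits pat with PatternAt-even {2 ^ k} (m^n>0 2 k) pat
... | a , M , refl , refl =
  ∈-scale-double {netUnits} {2 ^ k} {a} {M} (PatternAt⇒net k (2a+2b≤2n⇒a+b≤n {a} {M} {2 ^ (4 + k)} fits) (PatternAt-halve {2 ^ k} pat))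

factor : ∀ {A : Set} → (ℕ → A) → ℕ → ℕ → List A
factor u p zero    = []
factor u p (suc L) = u p ∷ factor u (suc p) L

module _ {A : Set} (u : ℕ → A) where

  length-factor : ∀ p L → length (factor u p L) ≡ L
  length-factor p zero    = refl
  length-factor p (suc L) = cong suc (length-factor (suc p) L)

  take-factor : ∀ M p L → take M (factor u p L) ≡ factor u p (M ⊓ L)
  take-factor zero    p L       = refl
  take-factor (suc M) p zero    = refl
  take-factor (suc M) p (suc L) = cong (u p ∷_) (take-factor M (suc p) L)

  drop-factor : ∀ d p L → drop d (factor u p L) ≡ factor u (p + d) (L ∸ d)
  drop-factor zero    p L       = cong (λ q → factor u q L) (sym (+-identityʳ p))
  drop-factor (suc d) p zero    = refl
  drop-factor (suc d) p (suc L) = trans (drop-factor d (suc p) L) (cong (λ q → factor u q (L ∸ d)) (sym (+-suc p d)))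

  factor-++ : ∀ p m n → factor u p (m + n) ≡ factor u p m ++ factor u (p + m) n
  factor-++ p zero    n = cong (λ q → factor u q n) (sym (+-identityʳ p))
  factor-++ p (suc m) n = cong (u p ∷_) (trans (factor-++ (suc p) m n) (cong (λ q → factor u (suc p) m ++ factor u q n) (sym (+-suc p m))))

  map-factor : ∀ {B : Set} (f : A → B) p L → map f (factor u p L) ≡ factor (f ∘ u) p L
  map-factor f p zero    = refl
  map-factor f p (suc L) = cong (f (u p) ∷_) (map-factor f (suc p) L)

factor-cong : ∀ {A : Set} {u v : ℕ → A} {x y} L → (∀ {k} → k < L → u (x + k) ≡ v (y + k)) → factor u x L ≡ factor v y L
factor-cong {x = x} {y} zero    eq = refl
factor-cong {u = u} {v} {x} {y} (suc L) eq = cong₂ _∷_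
  (trans (cong u (sym (+-identityʳ x))) (trans (eq (s≤s z≤n)) (cong v (+-identityʳ y))))
  (factor-cong L λ {k} k<L → trans (cong u (sym (+-suc x k))) (trans (eq (s≤s k<L)) (cong v (+-suc y k))))

factor-≡⇒ : ∀ {A : Set} {u v : ℕ → A} {x y} L → factor u x L ≡ factor v y L → ∀ {k} → k < L → u (x + k) ≡ v (y + k)
factor-≡⇒ {u = u} {v} {x} {y} (suc L) eq {zero} _ =
  trans (cong u (+-identityʳ x)) (trans (proj₁ (∷-injective eq)) (cong v (sym (+-identityʳ y))))
factor-≡⇒ {u = u} {v} {x} {y} (suc L) eq {suc k} (s≤s k<L) =
  trans (cong u (+-suc x k)) (trans (factor-≡⇒ L (proj₂ (∷-injective eq)) k<L) (cong v (sym (+-suc y k))))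

factor-≡⇔Agree : ∀ {p q L M} → factor t p L ≡ factor t q M ⇔ (L ≡ M × Agree p q L)
factor-≡⇔Agree {p} {q} {L} {M} = mk⇔ to from
  where
  to : factor t p L ≡ factor t q M → L ≡ M × Agree p q L
  to eq with trans (sym (length-factor t p L)) (trans (cong length eq) (length-factor t q M))
  ... | refl = refl , agree (factor-≡⇒ L eq)
  from : L ≡ M × Agree p q L → factor t p L ≡ factor t q M
  from (refl , e) = factor-cong L (at e)

factor-block : ∀ k c → factor t (c * 2 ^ k) (2 ^ k) ≡ map (t c xor_) (factor t 0 (2 ^ k))
factor-block k c = sym (trans (map-factor t (t c xor_) 0 (2 ^ k)) (factor-cong (2 ^ k) λ j<2^k → sym (t-block k c j<2^k)))

tm≡prefix : ∀ n → tm n ≡ factor t 0 (2 ^ n)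
tm≡prefix zero    = refl
tm≡prefix (suc n) = begin
  tm n ++ comp (tm n)                                 ≡⟨ cong (λ w → w ++ comp w) (tm≡prefix n) ⟩
  factor t 0 s ++ map not (factor t 0 s)              ≡⟨ cong (factor t 0 s ++_) (factor-block n 1) ⟨
  factor t 0 s ++ factor t (1 * s) s                  ≡⟨ cong (λ q → factor t 0 s ++ factor t q s) (*-identityˡ s) ⟩
  factor t 0 s ++ factor t s s                        ≡⟨ factor-++ t 0 s s ⟨
  factor t 0 (s + s)                                  ≡⟨ cong (λ L → factor t 0 (s + L)) (+-identityʳ s) ⟨
  factor t 0 (2 * s)                                  ∎
  where
  s : ℕ
  s = 2 ^ n
  open ≡-Reasoning

block-tm : ∀ k c → t c ≡ false → factor t (c * 2 ^ k) (2 ^ k) ≡ tm k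
block-tm k c tc≡false = begin
  factor t (c * 2 ^ k) (2 ^ k)        ≡⟨ factor-block k c ⟩
  map (t c xor_) (factor t 0 (2 ^ k)) ≡⟨ cong (λ b → map (b xor_) (factor t 0 (2 ^ k))) tc≡false ⟩
  map (false xor_) (factor t 0 (2 ^ k)) ≡⟨ map-id _ ⟩
  factor t 0 (2 ^ k)                  ≡⟨ tm≡prefix k ⟨
  tm k                                ∎
  where open ≡-Reasoning

block-comp : ∀ k c → t c ≡ true → factor t (c * 2 ^ k) (2 ^ k) ≡ comp (tm k)
block-comp k c tc≡true = begin
  factor t (c * 2 ^ k) (2 ^ k)        ≡⟨ factor-block k c ⟩
  map (t c xor_) (factor t 0 (2 ^ k)) ≡⟨ cong (λ b → map (b xor_) (factor t 0 (2 ^ k))) tc≡true ⟩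
  comp (factor t 0 (2 ^ k))           ≡⟨ cong comp (tm≡prefix k) ⟨
  comp (tm k)                         ∎
  where open ≡-Reasoning

𝒫-factors : ∀ k → 𝒫 (5 + k) ≡ map (λ (c , d) → factor t (c * 2 ^ k) (d * 2 ^ k)) patternUnits
𝒫-factors k = sym (cong₂ _∷_ word₁ (cong₂ _∷_ word₂ (cong₂ _∷_ word₃ (cong₂ _∷_ word₄ refl))))
  where
  s : ℕ
  s = 2 ^ k
  open ≡-Reasoning
  4s≡2*2s : ∀ s → 4 * s ≡ 2 * (2 * s)
  4s≡2*2s = solve-∀
  3s≡s+2s : ∀ s → 3 * s ≡ s + 2 * s
  3s≡s+2s = solve-∀
  3s+s≡4s : ∀ s → 3 * s + s ≡ 4 * s
  3s+s≡4s = solve-∀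
  2s+s≡3s : ∀ s → 2 * s + s ≡ 3 * s
  2s+s≡3s = solve-∀
  word₁ : factor t (0 * s) (4 * s) ≡ tm (2 + k)
  word₁ = trans (cong (factor t 0) (4s≡2*2s s)) (block-tm (2 + k) 0 refl)
  word₂ : factor t (4 * s) (4 * s) ≡ comp (tm (2 + k))
  word₂ = trans (cong₂ (factor t) (trans (4s≡2*2s s) (sym (*-identityˡ _))) (4s≡2*2s s)) (block-comp (2 + k) 1 refl)
  tm[1+k] : factor t (3 * s) (2 * s) ≡ tm (1 + k)
  tm[1+k] = begin
    factor t (3 * s) (2 * s)                        ≡⟨ cong (λ L → factor t (3 * s) (s + L)) (+-identityʳ s) ⟩
    factor t (3 * s) (s + s)                        ≡⟨ factor-++ t (3 * s) s s ⟩
    factor t (3 * s) s ++ factor t (3 * s + s) s    ≡⟨ cong₂ _++_ (block-tm k 3 refl) (trans (cong (λ q → factor t q s) (3s+s≡4s s)) (block-comp k 4 refl)) ⟩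
    tm k ++ comp (tm k)                             ∎
  word₃ : factor t (3 * s) (3 * s) ≡ tm k ++ comp (tm (1 + k))
  word₃ = begin
    factor t (3 * s) (3 * s)                            ≡⟨ cong (factor t (3 * s)) (3s≡s+2s s) ⟩
    factor t (3 * s) (s + 2 * s)                        ≡⟨ factor-++ t (3 * s) s (2 * s) ⟩
    factor t (3 * s) s ++ factor t (3 * s + s) (2 * s)  ≡⟨ cong₂ _++_ (block-tm k 3 refl)
                                                            (trans (cong (λ q → factor t q (2 * s)) (trans (3s+s≡4s s) (4s≡2*2s s))) (block-comp (1 + k) 2 refl)) ⟩
    tm k ++ comp (tm (1 + k))                           ∎
  word₄ : factor t (2 * s) (3 * s) ≡ comp (tm k) ++ tm (1 + k)
  word₄ = begin
    factor t (2 * s) (3 * s)                            ≡⟨ cong (factor t (2 * s)) (3s≡s+2s s) ⟩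
    factor t (2 * s) (s + 2 * s)                        ≡⟨ factor-++ t (2 * s) s (2 * s) ⟩
    factor t (2 * s) s ++ factor t (2 * s + s) (2 * s)  ≡⟨ cong₂ _++_ (block-comp k 2 refl) (trans (cong (λ q → factor t q (2 * s)) (2s+s≡3s s)) tm[1+k]) ⟩
    comp (tm k) ++ tm (1 + k)                           ∎

factor∈𝒫⇔PatternAt : ∀ k {p L} → factor t p L ∈ 𝒫 (5 + k) ⇔ PatternAt (2 ^ k) p L
factor∈𝒫⇔PatternAt k {p} {L} = mk⇔
  (λ w → Any.map (Equivalence.to factor-≡⇔Agree) (map⁻ (subst (factor t p L ∈_) (𝒫-factors k) w)))
  (λ pat → subst (factor t p L ∈_) (sym (𝒫-factors k)) (map⁺ (Any.map (Equivalence.from factor-≡⇔Agree) pat)))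

OccursAt : Str → Str → ℕ → Set
OccursAt P S q = take (length P) (drop q S) ≡ P

¬OccursAt-[] : ∀ {P} q → 1 ≤ length P → ¬ OccursAt P [] q
¬OccursAt-[] {P} q 1≤|P| occurs with trans (sym (take-[] (length P))) (trans (cong (take (length P)) (sym (drop-[] q))) occurs)
... | refl = 1+n≰n 1≤|P|

occurs⇒1≤occ : ∀ {P} S q → OccursAt P S q → 1 ≤ occAux P S
occurs⇒1≤occ {P} [] q occurs with ≡-dec _≟ᵇ_ (take (length P) []) P
... | yes _   = s≤s z≤n
... | no ¬hit = ⊥-elim (¬hit (subst (λ S → take (length P) S ≡ P) (drop-[] q) occurs))
occurs⇒1≤occ {P} (c ∷ S) q occurs with ≡-dec _≟ᵇ_ (take (length P) (c ∷ S)) P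
occurs⇒1≤occ {P} (c ∷ S) q       occurs | yes _   = s≤s z≤n
occurs⇒1≤occ {P} (c ∷ S) zero    occurs | no ¬hit = ⊥-elim (¬hit occurs)
occurs⇒1≤occ {P} (c ∷ S) (suc q) occurs | no _    = occurs⇒1≤occ S q occurs

occ-mono-∷ : ∀ P c S → occAux P S ≤ occAux P (c ∷ S)
occ-mono-∷ P c S with ≡-dec _≟ᵇ_ (take (length P) (c ∷ S)) P
... | yes _ = n≤1+n _
... | no _  = ≤-refl

occurs-twice⇒2≤occ : ∀ {P} S {q q′} → 1 ≤ length P → OccursAt P S q → OccursAt P S q′ → q ≢ q′ → 2 ≤ occAux P S
occurs-twice⇒2≤occ [] {q} 1≤|P| occurs _ _ = ⊥-elim (¬OccursAt-[] q 1≤|P| occurs)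
occurs-twice⇒2≤occ (c ∷ S) {zero} {zero} _ _ _ q≢q′ = ⊥-elim (q≢q′ refl)
occurs-twice⇒2≤occ {P} (c ∷ S) {suc q} {suc q′} 1≤|P| occurs occurs′ q≢q′ =
  ≤-trans (occurs-twice⇒2≤occ S 1≤|P| occurs occurs′ (q≢q′ ∘ cong suc)) (occ-mono-∷ P c S)
occurs-twice⇒2≤occ {P} (c ∷ S) {zero} {suc q′} _ occurs occurs′ _ with ≡-dec _≟ᵇ_ (take (length P) (c ∷ S)) P
... | yes _   = s≤s (occurs⇒1≤occ S q′ occurs′)
... | no ¬hit = ⊥-elim (¬hit occurs)
occurs-twice⇒2≤occ {P} (c ∷ S) {suc q} {zero} _ occurs occurs′ _ with ≡-dec _≟ᵇ_ (take (length P) (c ∷ S)) P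
... | yes _   = s≤s (occurs⇒1≤occ S q occurs)
... | no ¬hit = ⊥-elim (¬hit occurs′)

1≤occ⇒occurs : ∀ {P} S → 1 ≤ occAux P S → ∃ (OccursAt P S)
1≤occ⇒occurs {P} [] 1≤occ with ≡-dec _≟ᵇ_ (take (length P) []) P
... | yes hit = 0 , hit
1≤occ⇒occurs {P} (c ∷ S) 1≤occ with ≡-dec _≟ᵇ_ (take (length P) (c ∷ S)) P
... | yes hit = 0 , hit
... | no _ with 1≤occ⇒occurs S 1≤occ
...   | q , occurs = suc q , occurs

2≤occ⇒occurs-twice : ∀ {P} S → 2 ≤ occAux P S → ∃ λ q → ∃ λ q′ → q ≢ q′ × OccursAt P S q × OccursAt P S q′
2≤occ⇒occurs-twice {P} [] 2≤occ with ≡-dec _≟ᵇ_ (take (length P) []) P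
... | yes _ with 2≤occ
...   | s≤s ()
2≤occ⇒occurs-twice {P} (c ∷ S) 2≤occ with ≡-dec _≟ᵇ_ (take (length P) (c ∷ S)) P
... | yes hit with 1≤occ⇒occurs S (≤-pred 2≤occ)
...   | q , occurs = 0 , suc q , (λ ()) , hit , occurs
2≤occ⇒occurs-twice {P} (c ∷ S) 2≤occ | no _ with 2≤occ⇒occurs-twice S 2≤occ
...   | q , q′ , q≢q′ , occurs , occurs′ = suc q , suc q′ , q≢q′ ∘ suc-injective , occurs , occurs′

occ≡1⇔unique : ∀ {P} S {p} → 1 ≤ length P → OccursAt P S p → (occAux P S ≡ 1 ⇔ (∀ q → OccursAt P S q → q ≡ p))
occ≡1⇔unique {P} S {p} 1≤|P| occurs = mk⇔ to from
  where
  to : occAux P S ≡ 1 → ∀ q → OccursAt P S q → q ≡ p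
  to occ≡1 q occurs′ with q ≟ p
  ... | yes q≡p = q≡p
  ... | no q≢p  = ⊥-elim (1+n≰n (subst (2 ≤_) occ≡1 (occurs-twice⇒2≤occ S 1≤|P| occurs′ occurs q≢p)))
  from : (∀ q → OccursAt P S q → q ≡ p) → occAux P S ≡ 1
  from unique = ≤-antisym ≤1 (occurs⇒1≤occ S p occurs)
    where
    ≤1 : occAux P S ≤ 1
    ≤1 with occAux P S ≤? 1
    ... | yes ≤1 = ≤1
    ... | no ≰1 with 2≤occ⇒occurs-twice S (≰⇒> ≰1)
    ...   | q , q′ , q≢q′ , occurs₁ , occurs₂ = ⊥-elim (q≢q′ (trans (unique q occurs₁) (sym (unique q′ occurs₂))))

prefix : ℕ → Str
prefix N = factor t 0 N

window-of-prefix : ∀ N p q L → take (length (factor t p L)) (drop q (prefix N)) ≡ factor t q (L ⊓ (N ∸ q))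
window-of-prefix N p q L = begin
  take (length (factor t p L)) (drop q (prefix N))  ≡⟨ cong (λ M → take M (drop q (prefix N))) (length-factor t p L) ⟩
  take L (drop q (prefix N))                        ≡⟨ cong (take L) (drop-factor t q 0 N) ⟩
  take L (factor t q (N ∸ q))                       ≡⟨ take-factor t L q (N ∸ q) ⟩
  factor t q (L ⊓ (N ∸ q))                          ∎
  where open ≡-Reasoning

fits⇔≤∸ : ∀ {N q L} → 1 ≤ L → q + L ≤ N ⇔ L ≤ N ∸ q
fits⇔≤∸ {N} {q} {L} 1≤L = mk⇔
  (λ fits → m+n≤o⇒m≤o∸n L (subst (_≤ N) (+-comm q L) fits))
  (λ L≤N∸q → subst (_≤ N) (+-comm L q) (m≤o∸n⇒m+n≤o L (q≤N L≤N∸q) L≤N∸q))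
  where
  q≤N : L ≤ N ∸ q → q ≤ N
  q≤N L≤N∸q = <⇒≤ (m∸n≢0⇒n<m (λ N∸q≡0 → 1+n≰n (≤-trans 1≤L (subst (L ≤_) N∸q≡0 L≤N∸q))))

OccursAt-prefix⇔ : ∀ {N p q L} → 1 ≤ L → OccursAt (factor t p L) (prefix N) q ⇔ (q + L ≤ N × Agree p q L)
OccursAt-prefix⇔ {N} {p} {q} {L} 1≤L = mk⇔ to from
  where
  to : OccursAt (factor t p L) (prefix N) q → q + L ≤ N × Agree p q L
  to occurs with Equivalence.to factor-≡⇔Agree (trans (sym (window-of-prefix N p q L)) occurs)
  ... | L⊓≡L , e = Equivalence.from (fits⇔≤∸ 1≤L) (m⊓n≡m⇒m≤n L⊓≡L) , Agree-sym (subst (Agree q p) L⊓≡L e)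
  from : q + L ≤ N × Agree p q L → OccursAt (factor t p L) (prefix N) q
  from (fits , e) = trans (window-of-prefix N p q L)
    (Equivalence.from factor-≡⇔Agree (L⊓≡L , subst (Agree q p) (sym L⊓≡L) (Agree-sym e)))
    where
    L⊓≡L : L ⊓ (N ∸ q) ≡ L
    L⊓≡L = m≤n⇒m⊓n≡m (Equivalence.to (fits⇔≤∸ 1≤L) fits)

Repeats⇔2≤occ : ∀ {N p L} → 1 ≤ L → p + L ≤ N → Repeats N p L ⇔ 2 ≤ occ (factor t p L) (prefix N)
Repeats⇔2≤occ {N} {p} {L} 1≤L fits = mk⇔ to from
  where
  occurs⇔ : ∀ {q} → OccursAt (factor t p L) (prefix N) q ⇔ (q + L ≤ N × Agree p q L)
  occurs⇔ = OccursAt-prefix⇔ 1≤L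
  1≤|P| : 1 ≤ length (factor t p L)
  1≤|P| = subst (1 ≤_) (sym (length-factor t p L)) 1≤L
  self : OccursAt (factor t p L) (prefix N) p
  self = Equivalence.from occurs⇔ (fits , Agree-refl p L)
  to : Repeats N p L → 2 ≤ occ (factor t p L) (prefix N)
  to (q , q≢p , fitsq , e) = occurs-twice⇒2≤occ (prefix N) 1≤|P| (Equivalence.from occurs⇔ (fitsq , e)) self q≢p
  from : 2 ≤ occ (factor t p L) (prefix N) → Repeats N p L
  from 2≤occ with 2≤occ⇒occurs-twice (prefix N) 2≤occ
  ... | q , q′ , q≢q′ , occurs , occurs′ with q ≟ p
  ...   | yes refl = q′ , q≢q′ ∘ sym , Equivalence.to occurs⇔ occurs′
  ...   | no q≢p   = q , q≢p , Equivalence.to occurs⇔ occurs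

OccursOnce⇔occ≡1 : ∀ {N p L} → 1 ≤ L → p + L ≤ N → OccursOnce N p L ⇔ occ (factor t p L) (prefix N) ≡ 1
OccursOnce⇔occ≡1 {N} {p} {L} 1≤L fits = mk⇔
  (λ once → Equivalence.from unique⇔ λ q occurs → uncurry (once q) (Equivalence.to occurs⇔ occurs))
  (λ occ≡1 q fitsq e → Equivalence.to unique⇔ occ≡1 q (Equivalence.from occurs⇔ (fitsq , e)))
  where
  occurs⇔ : ∀ {q} → OccursAt (factor t p L) (prefix N) q ⇔ (q + L ≤ N × Agree p q L)
  occurs⇔ = OccursAt-prefix⇔ 1≤L
  unique⇔ : occ (factor t p L) (prefix N) ≡ 1 ⇔ (∀ q → OccursAt (factor t p L) (prefix N) q → q ≡ p)
  unique⇔ = occ≡1⇔unique (prefix N) (subst (1 ≤_) (sym (length-factor t p L)) 1≤L) (Equivalence.from occurs⇔ (fits , Agree-refl p L))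

sub-prefix : ∀ {N p L b} → b ≡ p + L → p + L ≤ N → sub (prefix N) (suc p) b ≡ factor t p L
sub-prefix {N} {p} {L} refl fits = begin
  take (p + L ∸ p) (drop p (prefix N))  ≡⟨ cong (λ M → take M (drop p (prefix N))) (m+n∸m≡n p L) ⟩
  take L (drop p (prefix N))            ≡⟨ cong (take L) (drop-factor t p 0 N) ⟩
  take L (factor t p (N ∸ p))           ≡⟨ take-factor t L p (N ∸ p) ⟩
  factor t p (L ⊓ (N ∸ p))              ≡⟨ cong (factor t p) (m≤n⇒m⊓n≡m (m+n≤o⇒m≤o∸n L (subst (_≤ N) (+-comm p L) fits))) ⟩
  factor t p L                          ∎
  where open ≡-Reasoning

LeftMaximal⇔ : ∀ {N p L} → p + L ≤ N →
               (suc p ≡ 1 ⊎ occ (sub (prefix N) p (p + L)) (prefix N) ≡ 1) ⇔ LeftMaximal N p L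
LeftMaximal⇔ {N} {zero}      _    = mk⇔ (λ _ → tt) (λ _ → inj₁ refl)
LeftMaximal⇔ {N} {suc p} {L} fits = mk⇔ to from
  where
  fits′ : p + suc L ≤ N
  fits′ = subst (_≤ N) (sym (+-suc p L)) fits
  once⇔ : OccursOnce N p (suc L) ⇔ occ (sub (prefix N) (suc p) (suc p + L)) (prefix N) ≡ 1
  once⇔ = subst (λ w → OccursOnce N p (suc L) ⇔ occ w (prefix N) ≡ 1) (sym (sub-prefix (sym (+-suc p L)) fits′))
                (OccursOnce⇔occ≡1 (s≤s z≤n) fits′)
  to : (suc (suc p) ≡ 1 ⊎ occ (sub (prefix N) (suc p) (suc p + L)) (prefix N) ≡ 1) → OccursOnce N p (suc L)
  to (inj₂ occ≡1) = Equivalence.from once⇔ occ≡1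
  from : OccursOnce N p (suc L) → suc (suc p) ≡ 1 ⊎ occ (sub (prefix N) (suc p) (suc p + L)) (prefix N) ≡ 1
  from once = inj₂ (Equivalence.to once⇔ once)

RightMaximal⇔ : ∀ {N p L} → p + L ≤ N →
                (p + L ≡ length (prefix N) ⊎ occ (sub (prefix N) (suc p) (suc (p + L))) (prefix N) ≡ 1) ⇔ RightMaximal N p L
RightMaximal⇔ {N} {p} {L} fits with p + L ≟ N
... | yes ends = mk⇔ (λ _ → inj₁ ends) (λ _ → inj₁ (trans ends (sym (length-factor t 0 N))))
... | no ¬ends = mk⇔ to from
  where
  fits′ : p + suc L ≤ N
  fits′ = subst (_≤ N) (sym (+-suc p L)) (≤∧≢⇒< fits ¬ends)
  once⇔ : OccursOnce N p (suc L) ⇔ occ (sub (prefix N) (suc p) (suc (p + L))) (prefix N) ≡ 1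
  once⇔ = subst (λ w → OccursOnce N p (suc L) ⇔ occ w (prefix N) ≡ 1) (sym (sub-prefix (sym (+-suc p L)) fits′))
                (OccursOnce⇔occ≡1 (s≤s z≤n) fits′)
  to : p + L ≡ length (prefix N) ⊎ occ (sub (prefix N) (suc p) (suc (p + L))) (prefix N) ≡ 1 → RightMaximal N p L
  to (inj₁ ends)  = ⊥-elim (¬ends (trans ends (length-factor t 0 N)))
  to (inj₂ occ≡1) = inj₂ (Equivalence.from once⇔ occ≡1)
  from : RightMaximal N p L → p + L ≡ length (prefix N) ⊎ occ (sub (prefix N) (suc p) (suc (p + L))) (prefix N) ≡ 1
  from (inj₁ ends) = ⊥-elim (¬ends ends)
  from (inj₂ once) = inj₂ (Equivalence.to once⇔ once)

IsOcc-prefix⁺ : ∀ {N p L} → 1 ≤ L → p + L ≤ N → IsOcc (prefix N) (suc p) (p + L)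
IsOcc-prefix⁺ {N} {p} {L} 1≤L fits =
  s≤s z≤n , subst (_≤ p + L) (+-comm p 1) (+-monoʳ-≤ p 1≤L) , subst (p + L ≤_) (sym (length-factor t 0 N)) fits

IsOcc-prefix⁻ : ∀ {N a b} → IsOcc (prefix N) a b → ∃ λ p → ∃ λ L → a ≡ suc p × b ≡ p + L × 1 ≤ L × p + L ≤ N
IsOcc-prefix⁻ {N} {suc p} {b} (_ , p<b , b≤|S|) =
  p , b ∸ p , refl , sym p+[b∸p]≡b , m+n≤o⇒m≤o∸n 1 p<b , subst₂ _≤_ (sym p+[b∸p]≡b) (length-factor t 0 N) b≤|S|
  where
  p+[b∸p]≡b : p + (b ∸ p) ≡ b
  p+[b∸p]≡b = m+[n∸m]≡n (<⇒≤ p<b)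

IsNetOcc⇔IsNet : ∀ {N p L} → 1 ≤ L → p + L ≤ N → IsNetOcc (prefix N) (suc p) (p + L) ⇔ IsNet N p L
IsNetOcc⇔IsNet {N} {p} {L} 1≤L fits = mk⇔
  (λ (_ , twice , left , right) →
     net fits (Equivalence.from repeats⇔ twice) (Equivalence.to (LeftMaximal⇔ fits) left) (Equivalence.to (RightMaximal⇔ fits) right))
  (λ (net _ repeats left right) →
     IsOcc-prefix⁺ 1≤L fits , Equivalence.to repeats⇔ repeats , Equivalence.from (LeftMaximal⇔ fits) left , Equivalence.from (RightMaximal⇔ fits) right)
  where
  repeats⇔ : Repeats N p L ⇔ 2 ≤ occ (sub (prefix N) (suc p) (p + L)) (prefix N)
  repeats⇔ = subst (λ w → Repeats N p L ⇔ 2 ≤ occ w (prefix N)) (sym (sub-prefix refl fits)) (Repeats⇔2≤occ 1≤L fits)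

interval : ℕ × ℕ → ℕ × ℕ
interval (p , L) = suc p , p + L

interval-injective : ∀ {u v} → interval u ≡ interval v → u ≡ v
interval-injective {p , L} {p′ , L′} eq with cong proj₁ eq
... | refl = cong (p ,_) (+-cancelˡ-≡ p L L′ (cong proj₂ eq))

∈-map-interval⇔ : ∀ {xs p L} → (suc p , p + L) ∈ map interval xs ⇔ (p , L) ∈ xs
∈-map-interval⇔ {xs} {p} {L} = mk⇔ (from-map ∘ ∈-map⁻ interval) (∈-map⁺ interval)
  where
  from-map : (∃ λ u → u ∈ xs × (suc p , p + L) ≡ interval u) → (p , L) ∈ xs
  from-map (u , u∈xs , eq) = subst (_∈ xs) (sym (interval-injective eq)) u∈xs

nineOcc-scaled : ∀ k → nineOcc (5 + k) ≡ map interval (netOccurrences (2 ^ k))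
nineOcc-scaled k =
  cong₂ _∷_ (entry 0 4 refl (4s s)) (cong₂ _∷_ (entry 6 4 (6s s) (4s s)) (cong₂ _∷_ (entry 12 4 (12s s) (4s s))
  (cong₂ _∷_ (entry 4 4 (4s s) (4s s)) (cong₂ _∷_ (entry 8 4 (8s s) (4s s)) (cong₂ _∷_ (entry 3 3 (3s s) (3s′ s))
  (cong₂ _∷_ (entry 10 3 (10s s) (3s′ s)) (cong₂ _∷_ (entry 2 3 refl (3s′ s)) (cong₂ _∷_ (entry 11 3 (11s s) (3s′ s)) refl))))))))
  where
  s : ℕ
  s = 2 ^ k
  entry : ∀ c d {x len} → x ≡ c * s → len ≡ d * s → (x + 1 , x + 1 + len ∸ 1) ≡ interval (c * s , d * s)
  entry c d {x} {len} refl refl = cong₂ _,_ (+-comm x 1) (cong (λ y → y + len ∸ 1) (+-comm x 1))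
  4s : ∀ s → 2 * (2 * s) ≡ 4 * s
  4s = solve-∀
  6s : ∀ s → 2 * (2 * s) + 2 * s ≡ 6 * s
  6s = solve-∀
  12s : ∀ s → 2 * (2 * (2 * s)) + 2 * (2 * s) ≡ 12 * s
  12s = solve-∀
  8s : ∀ s → 2 * (2 * (2 * s)) ≡ 8 * s
  8s = solve-∀
  3s : ∀ s → 2 * s + s ≡ 3 * s
  3s = solve-∀
  3s′ : ∀ s → s + 2 * s ≡ 3 * s
  3s′ = solve-∀
  10s : ∀ s → 2 * (2 * (2 * s)) + 2 * s ≡ 10 * s
  10s = solve-∀
  11s : ∀ s → 2 * (2 * (2 * s)) + 2 * s + s ≡ 11 * s
  11s = solve-∀

nineOcc⇔net : ∀ k {p L} → (suc p , p + L) ∈ nineOcc (5 + k) ⇔ (p , L) ∈ netOccurrences (2 ^ k)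
nineOcc⇔net k {p} {L} =
  subst (λ xs → (suc p , p + L) ∈ xs ⇔ (p , L) ∈ netOccurrences (2 ^ k)) (sym (nineOcc-scaled k)) ∈-map-interval⇔

module _ (k : ℕ) where

  private
    N : ℕ
    N = 2 ^ (4 + k)

  IsNetOcc⇔nineOcc : ∀ {a b} → IsOcc (prefix N) a b → IsNetOcc (prefix N) a b ⇔ (a , b) ∈ nineOcc (5 + k)
  IsNetOcc⇔nineOcc o with IsOcc-prefix⁻ {N} o
  ... | p , L , refl , refl , 1≤L , fits =
    ⇔.trans (IsNetOcc⇔IsNet 1≤L fits) (⇔.trans (net-characterisation k p L) (⇔.sym (nineOcc⇔net k)))

  sub∈𝒫⇔nineOcc : ∀ {a b} → IsOcc (prefix N) a b → sub (prefix N) a b ∈ 𝒫 (5 + k) ⇔ (a , b) ∈ nineOcc (5 + k)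
  sub∈𝒫⇔nineOcc o with IsOcc-prefix⁻ {N} o
  ... | p , L , refl , refl , 1≤L , fits =
    ⇔.trans (subst (λ w → w ∈ 𝒫 (5 + k) ⇔ PatternAt (2 ^ k) p L) (sym (sub-prefix refl fits)) (factor∈𝒫⇔PatternAt k))
            (⇔.trans (mk⇔ (PatternAt⇒net k fits) (net⇒PatternAt k)) (⇔.sym (nineOcc⇔net k)))

  nineOcc⇒IsOcc : ∀ {a b} → (a , b) ∈ nineOcc (5 + k) → IsOcc (prefix N) a b
  nineOcc⇒IsOcc {a} {b} m = from-net (∈-map⁻ interval (subst ((a , b) ∈_) (nineOcc-scaled k) m))
    where
    16s≡N : ∀ s → 16 * s ≡ 2 * (2 * (2 * (2 * s)))
    16s≡N = solve-∀
    from-net : (∃ λ u → u ∈ netOccurrences (2 ^ k) × (a , b) ≡ interval u) → IsOcc (prefix N) a b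
    from-net ((p , L) , m′ , refl) with ∈-netOccurrences-bounds (m^n>0 2 k) m′
    ... | 3≤L , fits = IsOcc-prefix⁺ (≤-trans (s≤s z≤n) 3≤L) (subst (p + L ≤_) (16s≡N (2 ^ k)) fits)

theorem40 : (i : ℕ) → 5 ≤ i → (a b : ℕ) →
    (IsNetOcc (T i) a b ⇔ (IsOcc (T i) a b × sub (T i) a b ∈ 𝒫 i))
    × (IsNetOcc (T i) a b ⇔ ((a , b) ∈ nineOcc i))
theorem40 (suc (suc (suc (suc (suc k))))) (s≤s (s≤s (s≤s (s≤s (s≤s z≤n))))) a b =
  subst (λ S → (IsNetOcc S a b ⇔ (IsOcc S a b × sub S a b ∈ 𝒫 (5 + k))) × (IsNetOcc S a b ⇔ ((a , b) ∈ nineOcc (5 + k))))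
        (sym (tm≡prefix (4 + k)))
        (mk⇔ (λ n → proj₁ n , Equivalence.from (sub∈𝒫⇔nineOcc k (proj₁ n)) (Equivalence.to (IsNetOcc⇔nineOcc k (proj₁ n)) n))
             (λ (o , w) → Equivalence.from (IsNetOcc⇔nineOcc k o) (Equivalence.to (sub∈𝒫⇔nineOcc k o) w)) ,
         mk⇔ (λ n → Equivalence.to (IsNetOcc⇔nineOcc k (proj₁ n)) n)
             (λ m → Equivalence.from (IsNetOcc⇔nineOcc k (nineOcc⇒IsOcc k m)) m))
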